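{- For every $n\ge1$ there exists a non-adaptive set $\mathcal{Q}$ of $\frac12(n^2+3n)$ query sequences over $\{0,1\}$ (no extra characters), each of length at most $n$, and an algorithm that, for any input sequence $s\in\{0,1\}^{\ell}$ with $0\le\ell\le n$, exactly recovers $s$ from the Levenshtein distances $d_L(s,q)$, $q\in\mathcal{Q}$.
   Context: The Levenshtein (edit) distance $d_L(x,y)$ is the minimal number of single-symbol insertions, deletions and substitutions transforming $x$ into $y$. Non-adaptive means the query set is fixed in advance independently of $s$; the length of $s$ is unknown. -}

module Defs where

open import Data.Bool using (Bool)
open import Data.List using (List; []; _∷_; _++_)
open import Data.Nat using (ℕ; zero; suc; _≤_)
open import Data.Product using (_×_)
open import Relation.Binary.PropositionalEquality using (_≡_)

Word : Set
Word = List Bool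

data EditStep : Word → Word → Set where
  ins : ∀ (u v : Word) (b : Bool) → EditStep (u ++ v) (u ++ b ∷ v)
  del : ∀ (u v : Word) (b : Bool) → EditStep (u ++ b ∷ v) (u ++ v)
  sub : ∀ (u v : Word) (a b : Bool) → EditStep (u ++ a ∷ v) (u ++ b ∷ v)

data Edits : ℕ → Word → Word → Set where
  done : ∀ {x} → Edits zero x x
  step : ∀ {k x y z} → EditStep x y → Edits k y z → Edits (suc k) x z

IsLevenshteinDist : Word → Word → ℕ → Set
IsLevenshteinDist x y d = Edits d x y × (∀ k → Edits k x y → d ≤ k)

{-# OPTIONS --safe #-}
-- A query q with |q| ≤ |s| is at distance at least |s| − |q| from s, with equality exactly when q is a
-- subsequence of s: an edit script of that length can only delete. Hence the distance to the empty word
-- gives |s|, and the distances to the probes 0^i 1^(j+1) of length at most n tell which of them are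
-- subsequences of s. Two words of the same length with the same probe subsequences are equal: strip
-- common first letters, and if the first letters differ then counting the ones of the word that starts
-- with 1 gives a contradiction. The decoder returns the unique word of length at most n consistent with
-- the distances.
module Submission where

open import Defs
open import Data.Bool using (true; false)
import Data.Bool as Bool
open import Data.List using (List; []; _∷_; _++_; length; map; replicate; filter; applyUpTo; head)
open import Data.List.Properties using (length-++; length-map; length-replicate; length-applyUpTo; ∷-injectiveʳ)
open import Data.List.Membership.Propositional using (_∈_)
open import Data.List.Membership.Propositional.Properties
  using (∈-map⁺; ∈-map⁻; ∈-++⁺ˡ; ∈-++⁺ʳ; ∈-applyUpTo⁺; ∈-applyUpTo⁻; ∈-filter⁺)
open import Data.List.Relation.Unary.All using (All; []; _∷_)
import Data.List.Relation.Unary.All as All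
import Data.List.Relation.Unary.All.Properties as All
open import Data.List.Relation.Unary.AllPairs using ([])
open import Data.List.Relation.Unary.Any using (here; there)
open import Data.List.Relation.Unary.Unique.Propositional using (Unique)
import Data.List.Relation.Unary.Unique.Propositional.Properties as Unique
open import Data.List.Relation.Binary.Pointwise using (Pointwise; []; _∷_)
import Data.List.Relation.Binary.Pointwise as Pointwise
open import Data.List.Relation.Binary.Sublist.Propositional
  using (_⊆_; []; _∷_; _∷ʳ_; minimum; ⊆-refl; ⊆-trans)
open import Data.List.Relation.Binary.Sublist.Propositional.Properties
  using (∷ˡ⁻; ∷ʳ⁻; ∷⁻; ∷⁻¹; ∷ʳ⁻¹; ++⁺; length-mono-≤)
open import Data.List.Relation.Binary.Sublist.DecPropositional Bool._≟_ using (_⊆?_)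
open import Data.Maybe using (just; fromMaybe)
open import Data.Nat using (ℕ; zero; suc; _+_; _*_; _∸_; _≤_; z≤n; s≤s; _≟_)
open import Data.Nat.Properties
open import Data.Nat.Tactic.RingSolver using (solve-∀)
open import Data.Product using (Σ; _×_; ∃-syntax; _,_; proj₁; proj₂)
open import Function using (_∘_; _⇔_; Equivalence; mk⇔)
import Function.Properties.Equivalence as ⇔
open import Level using (0ℓ)
open import Relation.Binary.Definitions using (DecidableEquality)
open import Relation.Binary.PropositionalEquality
  using (_≡_; refl; sym; trans; cong; cong₂; subst; module ≡-Reasoning)
open import Relation.Nullary using (¬_; Dec; yes; no; contradiction)
open import Relation.Nullary.Decidable using (_×-dec_; _→-dec_)
open import Relation.Unary using (Pred; Decidable)

module _ {A : Set} (_≟ᴬ_ : DecidableEquality A) (x : A) where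

  occurrences : List A → ℕ
  occurrences xs = length (filter (x ≟ᴬ_) xs)

  replicate-occurrences-⊆ : ∀ xs → replicate (occurrences xs) x ⊆ xs
  replicate-occurrences-⊆ [] = []
  replicate-occurrences-⊆ (y ∷ xs) with x ≟ᴬ y
  ... | yes refl = refl ∷ replicate-occurrences-⊆ xs
  ... | no _ = y ∷ʳ replicate-occurrences-⊆ xs

  replicate-⊆⇒≤-occurrences : ∀ {k xs} → replicate k x ⊆ xs → k ≤ occurrences xs
  replicate-⊆⇒≤-occurrences {zero} _ = z≤n
  replicate-⊆⇒≤-occurrences {suc k} {y ∷ xs} p with x ≟ᴬ y
  ... | yes refl = s≤s (replicate-⊆⇒≤-occurrences (∷⁻ p))
  ... | no x≢y = replicate-⊆⇒≤-occurrences (∷ʳ⁻ x≢y p)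

replicate-injective : ∀ {A : Set} {i j} (a : A) → replicate i a ≡ replicate j a → i ≡ j
replicate-injective {i = i} {j} a eq =
  trans (sym (length-replicate i)) (trans (cong length eq) (length-replicate j))

Pointwise-∈ : ∀ {A B : Set} {R S : A → B → Set} {xs ys x} →
  x ∈ xs → Pointwise R xs ys → Pointwise S xs ys → ∃[ y ] R x y × S x y
Pointwise-∈ (here refl) (r ∷ _) (s ∷ _) = _ , r , s
Pointwise-∈ (there x∈xs) (_ ∷ rs) (_ ∷ ss) = Pointwise-∈ x∈xs rs ss

head-filter-unique : ∀ {A : Set} {P : Pred A 0ℓ} (P? : Decidable P) {x xs} →
  x ∈ xs → P x → (∀ {y} → P y → y ≡ x) → head (filter P? xs) ≡ just x
head-filter-unique P? {xs = xs} x∈xs px unique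
  with filter P? xs | ∈-filter⁺ P? x∈xs px | All.all-filter P? xs
... | y ∷ _ | _ | py ∷ _ = cong just (unique py)

length-++-∷ : ∀ (u v : Word) b → length (u ++ b ∷ v) ≡ suc (length (u ++ v))
length-++-∷ [] v b = refl
length-++-∷ (_ ∷ u) v b = cong suc (length-++-∷ u v b)

EditStep-length : ∀ {x y} → EditStep x y → length x ≤ suc (length y)
EditStep-length (ins u v b) rewrite length-++-∷ u v b = m≤n⇒m≤1+n (n≤1+n _)
EditStep-length (del u v b) rewrite length-++-∷ u v b = ≤-refl
EditStep-length (sub u v a b) rewrite length-++-∷ u v a | length-++-∷ u v b = n≤1+n _

Edits-length : ∀ {k x y} → Edits k x y → length x ≤ k + length y
Edits-length done = ≤-refl
Edits-length (step e r) = ≤-trans (EditStep-length e) (s≤s (Edits-length r))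

-- A script that shortens x by as many symbols as it has steps can only delete.
Edits-shortening⇒⊆ : ∀ {k x y} → Edits k x y → length x ≡ k + length y → y ⊆ x
Edits-shortening⇒⊆ done _ = ⊆-refl
Edits-shortening⇒⊆ (step (del u v b) r) eq =
  ⊆-trans (Edits-shortening⇒⊆ r (suc-injective (trans (sym (length-++-∷ u v b)) eq)))
          (++⁺ (⊆-refl {x = u}) (b ∷ʳ ⊆-refl))
Edits-shortening⇒⊆ {suc k} {y = z} (step (ins u v b) r) eq = contradiction
  (begin
    suc (length (u ++ v)) ≡⟨ length-++-∷ u v b ⟨
    length (u ++ b ∷ v)   ≤⟨ Edits-length r ⟩
    k + length z          ≤⟨ n≤1+n _ ⟩
    suc k + length z      ≡⟨ eq ⟨
    length (u ++ v)       ∎)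
  1+n≰n
  where open ≤-Reasoning
Edits-shortening⇒⊆ {suc k} {y = z} (step (sub u v a b) r) eq = contradiction
  (begin
    suc k + length z      ≡⟨ eq ⟨
    length (u ++ a ∷ v)   ≡⟨ length-++-∷ u v a ⟩
    suc (length (u ++ v)) ≡⟨ length-++-∷ u v b ⟨
    length (u ++ b ∷ v)   ≤⟨ Edits-length r ⟩
    k + length z          ∎)
  1+n≰n
  where open ≤-Reasoning

EditStep-∷ : ∀ b {x y} → EditStep x y → EditStep (b ∷ x) (b ∷ y)
EditStep-∷ c (ins u v b) = ins (c ∷ u) v b
EditStep-∷ c (del u v b) = del (c ∷ u) v b
EditStep-∷ c (sub u v a b) = sub (c ∷ u) v a b

Edits-∷ : ∀ b {k x y} → Edits k x y → Edits k (b ∷ x) (b ∷ y)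
Edits-∷ b done = done
Edits-∷ b (step e r) = step (EditStep-∷ b e) (Edits-∷ b r)

⊆⇒Edits : ∀ {y x} → y ⊆ x → Edits (length x ∸ length y) x y
⊆⇒Edits [] = done
⊆⇒Edits {y} (_∷ʳ_ {ys = x} b p) =
  subst (λ k → Edits k (b ∷ x) y) (sym (+-∸-assoc 1 (length-mono-≤ p)))
    (step (del [] x b) (⊆⇒Edits p))
⊆⇒Edits (refl ∷ p) = Edits-∷ _ (⊆⇒Edits p)

Agrees : Word → Word → ℕ → Set
Agrees c q d = length q ≤ length c →
  (q ⊆ c → d ≡ length c ∸ length q) × (d ≡ length c ∸ length q → q ⊆ c)

agrees? : ∀ c q d → Dec (Agrees c q d)
agrees? c q d = length q ≤? length c →-dec ((q ⊆? c →-dec d ≟ m) ×-dec (d ≟ m →-dec q ⊆? c))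
  where
  m : ℕ
  m = length c ∸ length q

IsLevenshteinDist⇒Agrees : ∀ {s q d} → IsLevenshteinDist s q d → Agrees s q d
IsLevenshteinDist⇒Agrees {s} {q} {d} (edits , minimal) q≤s =
    (λ q⊆s → ≤-antisym (minimal _ (⊆⇒Edits q⊆s)) lower-bound)
  , (λ d≡ → Edits-shortening⇒⊆ edits (trans (sym (m∸n+n≡m q≤s)) (cong (_+ length q) (sym d≡))))
  where
  lower-bound : length s ∸ length q ≤ d
  lower-bound =
    subst (length s ∸ length q ≤_) (m+n∸n≡m d (length q)) (∸-monoˡ-≤ (length q) (Edits-length edits))

zeros ones : ℕ → Word
zeros k = replicate k false
ones k = replicate k true

probe : ℕ → ℕ → Word
probe i j = zeros i ++ ones (suc j)

length-probe : ∀ i j → length (probe i j) ≡ i + suc j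
length-probe zero j = length-replicate (suc j)
length-probe (suc i) j = cong suc (length-probe i j)

SameProbes : Word → Word → Set
SameProbes c s = ∀ i j → probe i j ⊆ c ⇔ probe i j ⊆ s

false∷-SameProbes : ∀ {c s} → SameProbes (false ∷ c) (false ∷ s) → SameProbes c s
false∷-SameProbes same i j = ⇔.trans (∷⁻¹ refl) (⇔.trans (same (suc i) j) (⇔.sym (∷⁻¹ refl)))

true∷-SameProbes : ∀ {c s} → SameProbes (true ∷ c) (true ∷ s) → SameProbes c s
true∷-SameProbes same zero j = ⇔.trans (∷⁻¹ refl) (⇔.trans (same zero (suc j)) (⇔.sym (∷⁻¹ refl)))
true∷-SameProbes same (suc i) j = ⇔.trans (∷ʳ⁻¹ λ ()) (⇔.trans (same (suc i) j) (⇔.sym (∷ʳ⁻¹ λ ())))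

-- With k the number of ones in s, 1^(k+1) is a subsequence of 1s, hence of 0c and so of c;
-- then 01^(k+1) is one of 0c, hence of 1s and so of s, which has only k ones.
¬SameProbes-false∷-true∷ : ∀ c s → ¬ SameProbes (false ∷ c) (true ∷ s)
¬SameProbes-false∷-true∷ c s same = 1+n≰n (replicate-⊆⇒≤-occurrences Bool._≟_ true (∷ˡ⁻ 01ᵏ⁺¹⊆s))
  where
  k : ℕ
  k = occurrences Bool._≟_ true s
  1ᵏ⁺¹⊆c : ones (suc k) ⊆ c
  1ᵏ⁺¹⊆c = ∷ʳ⁻ (λ ()) (Equivalence.from (same 0 k) (replicate-occurrences-⊆ Bool._≟_ true (true ∷ s)))
  01ᵏ⁺¹⊆s : false ∷ ones (suc k) ⊆ s
  01ᵏ⁺¹⊆s = ∷ʳ⁻ (λ ()) (Equivalence.to (same 1 k) (refl ∷ 1ᵏ⁺¹⊆c))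

SameProbes⇒≡ : ∀ c s → length c ≡ length s → SameProbes c s → c ≡ s
SameProbes⇒≡ [] [] _ _ = refl
SameProbes⇒≡ (false ∷ c) (false ∷ s) eq same =
  cong (false ∷_) (SameProbes⇒≡ c s (suc-injective eq) (false∷-SameProbes same))
SameProbes⇒≡ (true ∷ c) (true ∷ s) eq same =
  cong (true ∷_) (SameProbes⇒≡ c s (suc-injective eq) (true∷-SameProbes same))
SameProbes⇒≡ (false ∷ c) (true ∷ s) _ same =
  contradiction same (¬SameProbes-false∷-true∷ c s)
SameProbes⇒≡ (true ∷ c) (false ∷ s) _ same =
  contradiction (λ i j → ⇔.sym (same i j)) (¬SameProbes-false∷-true∷ s c)

-- blocks n lists the probes with at most n symbols.
blocks : ℕ → List Word
blocks zero = []
blocks (suc n) = map (false ∷_) (blocks n) ++ applyUpTo (ones ∘ suc) (suc n)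

queries : ℕ → List Word
queries n = applyUpTo zeros n ++ blocks n

probe∈blocks : ∀ i j {n} → i + suc j ≤ n → probe i j ∈ blocks n
probe∈blocks zero j {suc n} (s≤s j≤n) = ∈-++⁺ʳ _ (∈-applyUpTo⁺ (ones ∘ suc) (s≤s j≤n))
probe∈blocks (suc i) j {suc n} (s≤s i+j<n) = ∈-++⁺ˡ (∈-map⁺ (false ∷_) (probe∈blocks i j i+j<n))

probe∈queries : ∀ i j {n} → i + suc j ≤ n → probe i j ∈ queries n
probe∈queries i j i+j<n = ∈-++⁺ʳ _ (probe∈blocks i j i+j<n)

[]∈queries : ∀ {n} → 1 ≤ n → [] ∈ queries n
[]∈queries 0<n = ∈-++⁺ˡ (∈-applyUpTo⁺ zeros 0<n)

length-blocks : ∀ n → 2 * length (blocks n) ≡ n * suc n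
length-blocks zero = refl
length-blocks (suc n) = begin
  2 * length (blocks (suc n))       ≡⟨ cong (2 *_) length-blocks-suc ⟩
  2 * (length (blocks n) + suc n)   ≡⟨ *-distribˡ-+ 2 (length (blocks n)) (suc n) ⟩
  2 * length (blocks n) + 2 * suc n ≡⟨ cong (_+ 2 * suc n) (length-blocks n) ⟩
  n * suc n + 2 * suc n             ≡⟨ arithmetic n ⟩
  suc n * suc (suc n)               ∎
  where
  open ≡-Reasoning
  length-blocks-suc : length (blocks (suc n)) ≡ length (blocks n) + suc n
  length-blocks-suc = trans (length-++ (map (false ∷_) (blocks n)))
    (cong₂ _+_ (length-map (false ∷_) (blocks n)) (length-applyUpTo (ones ∘ suc) (suc n)))
  arithmetic : ∀ n → n * suc n + 2 * suc n ≡ suc n * suc (suc n)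
  arithmetic = solve-∀

length-queries : ∀ n → 2 * length (queries n) ≡ n * n + 3 * n
length-queries n = begin
  2 * length (queries n)                ≡⟨ cong (2 *_) (length-++ (applyUpTo zeros n)) ⟩
  2 * (length (applyUpTo zeros n) + length (blocks n))
    ≡⟨ cong (λ a → 2 * (a + length (blocks n))) (length-applyUpTo zeros n) ⟩
  2 * (n + length (blocks n))           ≡⟨ *-distribˡ-+ 2 n (length (blocks n)) ⟩
  2 * n + 2 * length (blocks n)         ≡⟨ cong (2 * n +_) (length-blocks n) ⟩
  2 * n + n * suc n                     ≡⟨ arithmetic n ⟩
  n * n + 3 * n                         ∎
  where
  open ≡-Reasoning
  arithmetic : ∀ n → 2 * n + n * suc n ≡ n * n + 3 * n
  arithmetic = solve-∀

blocks-bounded : ∀ n → All (λ q → length q ≤ n) (blocks n)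
blocks-bounded zero = []
blocks-bounded (suc n) = All.++⁺
  (All.map⁺ (All.map s≤s (blocks-bounded n)))
  (All.applyUpTo⁺₁ (ones ∘ suc) (suc n) λ {j} j<1+n →
    subst (_≤ suc n) (sym (length-replicate (suc j))) j<1+n)

queries-bounded : ∀ n → All (λ q → length q ≤ n) (queries n)
queries-bounded n = All.++⁺
  (All.applyUpTo⁺₁ zeros n λ {i} i<n → subst (_≤ n) (sym (length-replicate i)) (<⇒≤ i<n))
  (blocks-bounded n)

blocks-contain-true : ∀ n → All (true ∈_) (blocks n)
blocks-contain-true zero = []
blocks-contain-true (suc n) = All.++⁺
  (All.map⁺ (All.map there (blocks-contain-true n)))
  (All.applyUpTo⁺₂ (ones ∘ suc) (suc n) λ _ → here refl)

blocks-unique : ∀ n → Unique (blocks n)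
blocks-unique zero = []
blocks-unique (suc n) = Unique.++⁺
  (Unique.map⁺ ∷-injectiveʳ (blocks-unique n))
  (Unique.applyUpTo⁺₁ (ones ∘ suc) (suc n) λ i<j _ →
    <⇒≢ i<j ∘ suc-injective ∘ replicate-injective true)
  starts-with-false-and-true
  where
  starts-with-false-and-true : ∀ {v} →
    ¬ (v ∈ map (false ∷_) (blocks n) × v ∈ applyUpTo (ones ∘ suc) (suc n))
  starts-with-false-and-true (v∈0·blocks , v∈ones)
    with _ , _ , refl ← ∈-map⁻ (false ∷_) v∈0·blocks
    with _ , _ , () ← ∈-applyUpTo⁻ (ones ∘ suc) v∈ones

queries-unique : ∀ n → Unique (queries n)
queries-unique n = Unique.++⁺
  (Unique.applyUpTo⁺₁ zeros n λ i<j _ → <⇒≢ i<j ∘ replicate-injective false)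
  (blocks-unique n)
  zeros-and-blocks-disjoint
  where
  zeros-and-blocks-disjoint : ∀ {v} → ¬ (v ∈ applyUpTo zeros n × v ∈ blocks n)
  zeros-and-blocks-disjoint (v∈zeros , v∈blocks) with i , _ , refl ← ∈-applyUpTo⁻ zeros v∈zeros
    with () ← All.lookup (All.replicate⁺ {P = _≡ false} i refl)
                         (All.lookup (blocks-contain-true n) v∈blocks)

module _ {qs : List Word} {ds : List ℕ} {c c′ : Word}
         (c-agrees : Pointwise (Agrees c) qs ds) (c′-agrees : Pointwise (Agrees c′) qs ds) where

  agreeing-length : [] ∈ qs → length c ≡ length c′
  agreeing-length []∈qs with _ , agrees , agrees′ ← Pointwise-∈ []∈qs c-agrees c′-agrees =
    trans (sym (proj₁ (agrees z≤n) (minimum c))) (proj₁ (agrees′ z≤n) (minimum c′))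

  agreeing-⊆ : length c ≡ length c′ → ∀ {q} → q ∈ qs → q ⊆ c → q ⊆ c′
  agreeing-⊆ c≡c′ {q} q∈qs q⊆c with _ , agrees , agrees′ ← Pointwise-∈ q∈qs c-agrees c′-agrees =
    proj₂ (agrees′ (subst (length q ≤_) c≡c′ q≤c))
          (trans (proj₁ (agrees q≤c) q⊆c) (cong (_∸ length q) c≡c′))
    where
    q≤c : length q ≤ length c
    q≤c = length-mono-≤ q⊆c

probe-⊆⇒∈queries : ∀ {i j c n} → length c ≤ n → probe i j ⊆ c → probe i j ∈ queries n
probe-⊆⇒∈queries {i} {j} c≤n p =
  probe∈queries i j (subst (_≤ _) (length-probe i j) (≤-trans (length-mono-≤ p) c≤n))

Consistent : ℕ → List ℕ → Word → Set
Consistent n ds c = Pointwise (Agrees c) (queries n) ds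

consistent? : ∀ n ds → Decidable (Consistent n ds)
consistent? n ds c = Pointwise.decidable (agrees? c) (queries n) ds

consistent-unique : ∀ {n ds c s} → 1 ≤ n → length s ≤ n → Consistent n ds c → Consistent n ds s → c ≡ s
consistent-unique {n} {c = c} {s} 0<n s≤n c-ok s-ok = SameProbes⇒≡ c s c≡s λ i j →
  mk⇔ (λ p → agreeing-⊆ c-ok s-ok c≡s (probe-⊆⇒∈queries c≤n p) p)
      (λ p → agreeing-⊆ s-ok c-ok (sym c≡s) (probe-⊆⇒∈queries s≤n p) p)
  where
  c≡s : length c ≡ length s
  c≡s = agreeing-length c-ok s-ok ([]∈queries 0<n)
  c≤n : length c ≤ n
  c≤n = subst (_≤ n) (sym c≡s) s≤n

wordsUpTo : ℕ → List Word
wordsUpTo zero = [] ∷ []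
wordsUpTo (suc n) = [] ∷ map (false ∷_) (wordsUpTo n) ++ map (true ∷_) (wordsUpTo n)

∈-wordsUpTo : ∀ {n} s → length s ≤ n → s ∈ wordsUpTo n
∈-wordsUpTo {zero} [] _ = here refl
∈-wordsUpTo {suc n} [] _ = here refl
∈-wordsUpTo {suc n} (false ∷ s) (s≤s s≤n) =
  there (∈-++⁺ˡ (∈-map⁺ (false ∷_) (∈-wordsUpTo s s≤n)))
∈-wordsUpTo {suc n} (true ∷ s) (s≤s s≤n) =
  there (∈-++⁺ʳ _ (∈-map⁺ (true ∷_) (∈-wordsUpTo s s≤n)))

decode : ℕ → List ℕ → Word
decode n ds = fromMaybe [] (head (filter (consistent? n ds) (wordsUpTo n)))

mainTheorem8 : ∀ (n : ℕ) → 1 ≤ n →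
    Σ (List Word) λ Q →
      Unique Q
      × 2 * length Q ≡ n * n + 3 * n
      × All (λ q → length q ≤ n) Q
      × Σ (List ℕ → Word) λ decode →
          ∀ (s : Word) → length s ≤ n →
          ∀ (ds : List ℕ) → Pointwise (IsLevenshteinDist s) Q ds →
          decode ds ≡ s
mainTheorem8 n 0<n =
  queries n , queries-unique n , length-queries n , queries-bounded n , decode n ,
  λ s s≤n ds distances →
    let s-consistent = Pointwise.map IsLevenshteinDist⇒Agrees distances in
    cong (fromMaybe [])
      (head-filter-unique (consistent? n ds) (∈-wordsUpTo s s≤n) s-consistent
        λ c-consistent → consistent-unique 0<n s≤n c-consistent s-consistent)
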